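{- For $n \in \mathbb{Z}_{\ge 0}$ let $st_2(n)$ denote the maximum stairs2 index over all rooted binary trees with $n$ leaves. Then $st_2(0)=st_2(1)=0$, and for $n\ge 2$, with $k=2^{\lfloor \log_2 n\rfloor}$, $$st_2(n)=\frac{1}{n-1}\left((k-1)+(n-k-1)\cdot st_2(n-k)+\frac{n-k}{k}\right).$$
   Context: A rooted binary tree is a rooted tree (directed, unique root of in-degree zero, unique directed path from the root to every vertex) in which every non-leaf (inner) vertex has exactly two children; trees are considered up to isomorphism; with $0$ leaves it is the empty graph and with $1$ leaf a single vertex. For a vertex $v$, $n_v$ is the number of leaves among $v$ and its descendants. The stairs2 index of a rooted binary tree $T$ with $n$ leaves is $st_2(T)=0$ if $n\in\{0,1\}$, and for $n\ge 2$ $$st_2(T)=\frac{1}{n-1}\sum_{v \text{ inner vertex of } T}\frac{\min\{n_{v_1},n_{v_2}\}}{\max\{n_{v_1},n_{v_2}\}},$$ where $v_1,v_2$ are the two children of $v$. -}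

module Defs where

open import Data.Nat using (ℕ; zero; suc; _+_; _⊓_; _⊔_)
open import Data.Integer using (+_)
open import Data.Rational using (ℚ; _/_; 0ℚ; _≤_)
import Data.Rational as ℚ
open import Data.Product using (Σ; _×_)
open import Relation.Binary.PropositionalEquality using (_≡_)

-- Isomorphism classes correspond to these terms modulo swapping children;
-- st₂ is invariant under swapping, so maxima are unaffected.
data BTree : Set where
  leaf : BTree
  node : BTree → BTree → BTree

data RBTree : Set where
  empty : RBTree
  tree  : BTree → RBTree

leaves-1 : BTree → ℕ
leaves-1 leaf = 0
leaves-1 (node l r) = suc (leaves-1 l + leaves-1 r)

leavesB : BTree → ℕ
leavesB t = suc (leaves-1 t)

leaves : RBTree → ℕ
leaves empty = 0
leaves (tree t) = leavesB t

balanceSum : BTree → ℚ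
balanceSum leaf = 0ℚ
balanceSum (node l r) =
  ((+ (leavesB l ⊓ leavesB r)) / suc (leaves-1 l ⊔ leaves-1 r))
  ℚ.+ (balanceSum l ℚ.+ balanceSum r)

st2B : BTree → ℚ
st2B leaf = 0ℚ
st2B (node l r) = ((+ 1) / leaves-1 (node l r)) ℚ.* balanceSum (node l r)

st2 : RBTree → ℚ
st2 empty = 0ℚ
st2 (tree t) = st2B t

IsMaxSt2 : ℕ → ℚ → Set
IsMaxSt2 n q =
  Σ RBTree (λ T → leaves T ≡ n × st2 T ≡ q)
  × (∀ (T : RBTree) → leaves T ≡ n → st2 T ≤ q)

module Submission where

-- Let F = maxBalance: F 0 = 0 and F (2 ^ j + r) = (2 ^ j - 1) + r / 2 ^ j + F r for r < 2 ^ j.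
-- F n is the maximum of balanceSum over trees with n leaves; since (r - 1) st₂(r) = F r,
-- dividing by n - 1 gives the recurrence.  F n is attained by joining a perfect tree with
-- 2 ^ j leaves to an optimal tree with r leaves.  For the upper bound it suffices, by
-- induction on trees, that a new root never beats F:
--   min(a,b)/max(a,b) + F a + F b ≤ F (a + b).
-- This goes by strong induction on a + b, with K = 2 ^ j ≤ a + b < 2K and a ≤ b.  If b ≥ K,
-- peel K off b.  Otherwise b = H + s with H = K/2, and either a = H + t or a < H.  After
-- unfolding F at the leading powers of two, both cases reduce to the elementary inequality
--   a/(H+s) + s/H ≤ 1 + m/(2H)   for a + s = H + m, s ≤ H, a ≤ H + s,
-- the induction hypothesis for the smaller pair paying the remaining t/H, resp. m/H.

open import Defs
open import Data.Nat using (ℕ; suc; _∸_; _^_)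
open import Data.Nat.Properties using (m^n≢0)
open import Data.Nat.Logarithm using (⌊log₂_⌋)
open import Data.Integer using (+_; -_)
import Data.Integer as ℤ
open import Data.Rational using (ℚ; _/_; 0ℚ)
import Data.Rational as ℚ
open import Data.Product using (Σ; _×_)
open import Relation.Binary.PropositionalEquality using (_≡_)

open import Data.Nat using (zero; _+_; _*_; _⊓_; _⊔_; _≤_; _<_; _≤?_; z≤n; s≤s; NonZero; ⌊_/2⌋)
import Data.Nat.Properties as ℕ
open import Data.Nat.Induction using (<-rec)
open import Data.Nat.Logarithm using (⌊log₂⌊n/2⌋⌋≡⌊log₂n⌋∸1)
import Data.Integer.Properties as ℤ
import Data.Integer.Tactic.RingSolver as ℤ
open import Data.Rational using (1ℚ; toℚᵘ)
import Data.Rational.Properties as ℚ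
open import Data.Rational.Solver using (module +-*-Solver)
open +-*-Solver using (solve; _:+_; _:=_; :-_; con)
open import Data.Rational.Unnormalised as ℚᵘ using (mkℚᵘ; *≡*; *≤*)
import Data.Rational.Unnormalised.Properties as ℚᵘ
open import Data.Product using (_,_)
open import Relation.Nullary using (yes; no)
open import Data.Sum using (inj₁; inj₂)
open import Data.Empty using (⊥-elim)
open import Relation.Binary.PropositionalEquality using (refl; sym; trans; cong; cong₂; subst; subst₂; module ≡-Reasoning)
import Relation.Binary.Reasoning.Setoid as SetoidReasoning
open import Algebra.Properties.CommutativeSemigroup ℕ.+-commutativeSemigroup using (x∙yz≈y∙xz; xy∙z≈xz∙y; interchange)

infixl 7 _÷_

-- Junk value: x ÷ 0 = 0ℚ.
_÷_ : ℕ → ℕ → ℚ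
x ÷ zero  = 0ℚ
x ÷ suc d = + x / suc d

toℚᵘ-÷ : ∀ x d → toℚᵘ (x ÷ suc d) ℚᵘ.≃ mkℚᵘ (+ x) d
toℚᵘ-÷ x d = ℚ.toℚᵘ-fromℚᵘ (mkℚᵘ (+ x) d)

/≡÷ : ∀ x n .{{_ : NonZero n}} → + x / n ≡ x ÷ n
/≡÷ x (suc d) = refl

÷-nonNeg : ∀ x y → 0ℚ ℚ.≤ x ÷ y
÷-nonNeg x zero    = ℚ.≤-refl
÷-nonNeg x (suc d) = ℚ.nonNegative⁻¹ (x ÷ suc d) {{ℚ.normalize-nonNeg x (suc d)}}

÷-≤-cross : ∀ {x y z w} .{{_ : NonZero w}} → x * w ≤ z * y → x ÷ y ℚ.≤ z ÷ w
÷-≤-cross {x} {zero}  {z} {w}     _  = ÷-nonNeg z w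
÷-≤-cross {x} {suc b} {z} {suc d} le = ℚ.toℚᵘ-cancel-≤
  (ℚᵘ.≤-respˡ-≃ (ℚᵘ.≃-sym (toℚᵘ-÷ x b)) (ℚᵘ.≤-respʳ-≃ (ℚᵘ.≃-sym (toℚᵘ-÷ z d))
    (*≤* (subst₂ ℤ._≤_ (ℤ.pos-* x (suc d)) (ℤ.pos-* z (suc b)) (ℤ.+≤+ le)))))

÷-≡-cross : ∀ {x y z w} .{{_ : NonZero y}} .{{_ : NonZero w}} → x * w ≡ z * y → x ÷ y ≡ z ÷ w
÷-≡-cross eq = ℚ.≤-antisym (÷-≤-cross (ℕ.≤-reflexive eq)) (÷-≤-cross (ℕ.≤-reflexive (sym eq)))

÷-mono-≤ : ∀ {x y z w} .{{_ : NonZero w}} → x ≤ z → w ≤ y → x ÷ y ℚ.≤ z ÷ w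
÷-mono-≤ x≤z w≤y = ÷-≤-cross (ℕ.*-mono-≤ x≤z w≤y)

÷-+ : ∀ x z y → x ÷ y ℚ.+ z ÷ y ≡ (x + z) ÷ y
÷-+ x z zero    = refl
÷-+ x z (suc d) = ℚ.toℚᵘ-injective (begin
  toℚᵘ (x ÷ suc d ℚ.+ z ÷ suc d)          ≈⟨ ℚ.toℚᵘ-homo-+ (x ÷ suc d) (z ÷ suc d) ⟩
  toℚᵘ (x ÷ suc d) ℚᵘ.+ toℚᵘ (z ÷ suc d)  ≈⟨ ℚᵘ.+-cong (toℚᵘ-÷ x d) (toℚᵘ-÷ z d) ⟩
  mkℚᵘ (+ x) d ℚᵘ.+ mkℚᵘ (+ z) d          ≈⟨ *≡* (common (+ x) (+ z) (+ suc d)) ⟩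
  mkℚᵘ (+ (x + z)) d                       ≈⟨ toℚᵘ-÷ (x + z) d ⟨
  toℚᵘ ((x + z) ÷ suc d)                   ∎)
  where
  open SetoidReasoning ℚᵘ.≃-setoid
  common : ∀ X Z D → (X ℤ.* D ℤ.+ Z ℤ.* D) ℤ.* D ≡ (X ℤ.+ Z) ℤ.* (D ℤ.* D)
  common = ℤ.solve-∀

÷-* : ∀ x y z w .{{_ : NonZero y}} .{{_ : NonZero w}} → x ÷ y ℚ.* (z ÷ w) ≡ (x * z) ÷ (y * w)
÷-* x (suc b) z (suc d) = ℚ.toℚᵘ-injective (begin
  toℚᵘ (x ÷ suc b ℚ.* (z ÷ suc d))          ≈⟨ ℚ.toℚᵘ-homo-* (x ÷ suc b) (z ÷ suc d) ⟩
  toℚᵘ (x ÷ suc b) ℚᵘ.* toℚᵘ (z ÷ suc d)   ≈⟨ ℚᵘ.*-cong (toℚᵘ-÷ x b) (toℚᵘ-÷ z d) ⟩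
  mkℚᵘ (+ x) b ℚᵘ.* mkℚᵘ (+ z) d           ≈⟨ ℚᵘ.≃-reflexive (cong (λ n → mkℚᵘ n _) (sym (ℤ.pos-* x z))) ⟩
  mkℚᵘ (+ (x * z)) (d + b * suc d)          ≈⟨ toℚᵘ-÷ (x * z) (d + b * suc d) ⟨
  toℚᵘ ((x * z) ÷ (suc b * suc d))          ∎)
  where open SetoidReasoning ℚᵘ.≃-setoid

n÷n≡1 : ∀ n .{{_ : NonZero n}} → n ÷ n ≡ 1ℚ
n÷n≡1 n = ÷-≡-cross {n} {n} {1} {1} (ℕ.*-comm n 1)

0÷n≡0 : ∀ n → 0 ÷ n ≡ 0ℚ
0÷n≡0 zero    = refl
0÷n≡0 (suc d) = ÷-≡-cross {0} {suc d} {0} {1} refl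

÷-double : ∀ x y → (x + x) ÷ (y + y) ≡ x ÷ y
÷-double x zero    = refl
÷-double x y@(suc _) = ÷-≡-cross {x + x} {y + y} {x} {y}
  (trans (ℕ.*-distribʳ-+ y x x) (sym (ℕ.*-distribˡ-+ x y y)))

[n∸1]+[n∸1]+1 : ∀ n .{{_ : NonZero n}} → (n ∸ 1) ÷ 1 ℚ.+ (n ∸ 1) ÷ 1 ℚ.+ 1ℚ ≡ (n + n ∸ 1) ÷ 1
[n∸1]+[n∸1]+1 (suc k) = begin
  k ÷ 1 ℚ.+ k ÷ 1 ℚ.+ 1 ÷ 1   ≡⟨ cong (ℚ._+ 1 ÷ 1) (÷-+ k k 1) ⟩
  (k + k) ÷ 1 ℚ.+ 1 ÷ 1       ≡⟨ ÷-+ (k + k) 1 1 ⟩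
  (k + k + 1) ÷ 1             ≡⟨ cong (_÷ 1) (trans (ℕ.+-comm (k + k) 1) (sym (ℕ.+-suc k k))) ⟩
  (k + suc k) ÷ 1             ∎
  where open ≡-Reasoning

+-cancelˡ-≤ : ∀ r {p q} → r ℚ.+ p ℚ.≤ r ℚ.+ q → p ℚ.≤ q
+-cancelˡ-≤ r {p} {q} r+p≤r+q = begin
  p                        ≡⟨ solve 2 (λ r p → p := :- r :+ (r :+ p)) refl r p ⟩
  ℚ.- r ℚ.+ (r ℚ.+ p)      ≤⟨ ℚ.+-monoʳ-≤ (ℚ.- r) r+p≤r+q ⟩
  ℚ.- r ℚ.+ (r ℚ.+ q)      ≡⟨ solve 2 (λ r q → :- r :+ (r :+ q) := q) refl r q ⟩
  q                        ∎
  where open ℚ.≤-Reasoning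

p≤q+p : ∀ p {q} → 0ℚ ℚ.≤ q → p ℚ.≤ q ℚ.+ p
p≤q+p p {q} 0≤q = subst (ℚ._≤ q ℚ.+ p) (ℚ.+-identityˡ p) (ℚ.+-monoˡ-≤ p 0≤q)

-- With f = H + s ∸ a one has s + s = f + m, so s/H = (f + m)/(2H); and f/(2H) ≤ f/(H+s) = 1 - a/(H+s).
root-gain-bound : ∀ H a s m .{{_ : NonZero H}} → s ≤ H → a ≤ H + s → a + s ≡ H + m →
                  a ÷ (H + s) ℚ.+ s ÷ H ℚ.≤ 1ℚ ℚ.+ m ÷ (H + H)
root-gain-bound H@(suc _) a s m s≤H a≤H+s a+s≡H+m = begin
  a ÷ (H + s) ℚ.+ s ÷ H                                  ≡⟨ cong (a ÷ (H + s) ℚ.+_) (÷-double s H) ⟨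
  a ÷ (H + s) ℚ.+ (s + s) ÷ (H + H)                      ≡⟨ cong (λ k → a ÷ (H + s) ℚ.+ k ÷ (H + H)) s+s≡f+m ⟩
  a ÷ (H + s) ℚ.+ (f + m) ÷ (H + H)                      ≡⟨ cong (a ÷ (H + s) ℚ.+_) (÷-+ f m (H + H)) ⟨
  a ÷ (H + s) ℚ.+ (f ÷ (H + H) ℚ.+ m ÷ (H + H))          ≤⟨ ℚ.+-monoʳ-≤ (a ÷ (H + s)) (ℚ.+-monoˡ-≤ (m ÷ (H + H)) f÷2H≤f÷[H+s]) ⟩
  a ÷ (H + s) ℚ.+ (f ÷ (H + s) ℚ.+ m ÷ (H + H))          ≡⟨ ℚ.+-assoc (a ÷ (H + s)) (f ÷ (H + s)) (m ÷ (H + H)) ⟨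
  a ÷ (H + s) ℚ.+ f ÷ (H + s) ℚ.+ m ÷ (H + H)            ≡⟨ cong (ℚ._+ m ÷ (H + H)) (÷-+ a f (H + s)) ⟩
  (a + f) ÷ (H + s) ℚ.+ m ÷ (H + H)                      ≡⟨ cong (λ k → k ÷ (H + s) ℚ.+ m ÷ (H + H)) a+f≡H+s ⟩
  (H + s) ÷ (H + s) ℚ.+ m ÷ (H + H)                      ≡⟨ cong (ℚ._+ m ÷ (H + H)) (n÷n≡1 (H + s)) ⟩
  1ℚ ℚ.+ m ÷ (H + H)                                     ∎
  where
  open ℚ.≤-Reasoning
  f : ℕ
  f = H + s ∸ a
  a+f≡H+s : a + f ≡ H + s
  a+f≡H+s = ℕ.m+[n∸m]≡n a≤H+s
  f÷2H≤f÷[H+s] : f ÷ (H + H) ℚ.≤ f ÷ (H + s)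
  f÷2H≤f÷[H+s] = ÷-mono-≤ {f} {H + H} {f} ℕ.≤-refl (ℕ.+-monoʳ-≤ H s≤H)
  s+s≡f+m : s + s ≡ f + m
  s+s≡f+m = ℕ.+-cancelˡ-≡ a _ _ (trans (sym (ℕ.+-assoc a s s)) (trans (cong (_+ s) a+s≡H+m)
    (trans (xy∙z≈xz∙y H m s) (trans (cong (_+ m) (sym a+f≡H+s)) (ℕ.+-assoc a f m)))))

2^suc : ∀ i → 2 ^ suc i ≡ 2 ^ i + 2 ^ i
2^suc i = cong (λ k → 2 ^ i + k) (ℕ.+-identityʳ (2 ^ i))

n<2^n : ∀ n → n < 2 ^ n
n<2^n zero    = s≤s z≤n
n<2^n (suc n) = subst₂ _<_ (ℕ.+-comm n 1) (sym (2^suc n)) (ℕ.+-mono-<-≤ (n<2^n n) (ℕ.m^n>0 2 n))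

2^j+r<2^1+j : ∀ j {r} → r < 2 ^ j → 2 ^ j + r < 2 ^ suc j
2^j+r<2^1+j j {r} r<2^j = subst (2 ^ j + r <_) (sym (2^suc j)) (ℕ.+-monoʳ-< (2 ^ j) r<2^j)

2^j+r-induction : (P : ℕ → Set) → P 0 →
                  (∀ j r → r < 2 ^ j → (∀ m → m < 2 ^ j → P m) → P (2 ^ j + r)) →
                  ∀ n → P n
2^j+r-induction P P0 step n = below n n (n<2^n n)
  where
  below : ∀ j n → n < 2 ^ j → P n
  below zero    zero    _         = P0
  below zero    (suc _) (s≤s ())
  below (suc j) n       n<2^1+j with 2 ^ j ≤? n
  ... | no  2^j≰n = below j n (ℕ.≰⇒> 2^j≰n)
  ... | yes 2^j≤n = subst P (ℕ.m+[n∸m]≡n 2^j≤n) (step j (n ∸ 2 ^ j) r<2^j (below j))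
    where
    r<2^j : n ∸ 2 ^ j < 2 ^ j
    r<2^j = ℕ.+-cancelˡ-< (2 ^ j) _ _
      (subst₂ _<_ (sym (ℕ.m+[n∸m]≡n 2^j≤n)) (2^suc j) n<2^1+j)

-- The candidate maximum

-- balanceSum (node l r) unfolds to balance (leavesB l) (leavesB r) ℚ.+ (balanceSum l ℚ.+ balanceSum r).
balance : ℕ → ℕ → ℚ
balance a b = (a ⊓ b) ÷ (a ⊔ b)

balance-comm : ∀ a b → balance a b ≡ balance b a
balance-comm a b = cong₂ _÷_ (ℕ.⊓-comm a b) (ℕ.⊔-comm a b)

balance-≤ : ∀ {a b} → a ≤ b → balance a b ≡ a ÷ b
balance-≤ a≤b = cong₂ _÷_ (ℕ.m≤n⇒m⊓n≡m a≤b) (ℕ.m≤n⇒m⊔n≡n a≤b)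

÷≤balance : ∀ {x a b H} .{{_ : NonZero H}} → x ≤ a ⊓ b → a ⊔ b ≤ H → x ÷ H ℚ.≤ balance a b
÷≤balance {x} {a} {b} {H} x≤a⊓b a⊔b≤H with a ⊔ b | ℕ.m⊓n≤m⊔n a b
... | suc _ | _      = ÷-mono-≤ x≤a⊓b a⊔b≤H
... | zero  | a⊓b≤0 = ℚ.≤-reflexive (begin
  x ÷ H  ≡⟨ cong (_÷ H) (ℕ.n≤0⇒n≡0 (ℕ.≤-trans x≤a⊓b a⊓b≤0)) ⟩
  0 ÷ H  ≡⟨ 0÷n≡0 H ⟩
  0ℚ     ∎)
  where open ≡-Reasoning

balance-self : ∀ n .{{_ : NonZero n}} → balance n n ≡ 1ℚ
balance-self n = trans (balance-≤ {n} {n} ℕ.≤-refl) (n÷n≡1 n)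

-- With fuel j this peels off the leading power of two; it is meaningful for n < 2 ^ j.
maxBalance′ : ℕ → ℕ → ℚ
maxBalance′ zero    n = 0ℚ
maxBalance′ (suc j) n with 2 ^ j ≤? n
... | no  _ = maxBalance′ j n
... | yes _ = (2 ^ j ∸ 1) ÷ 1 ℚ.+ (n ∸ 2 ^ j) ÷ 2 ^ j ℚ.+ maxBalance′ j (n ∸ 2 ^ j)

maxBalance : ℕ → ℚ
maxBalance n = maxBalance′ n n

maxBalance′-< : ∀ j n → n < 2 ^ j → maxBalance′ (suc j) n ≡ maxBalance′ j n
maxBalance′-< j n n<2^j with 2 ^ j ≤? n
... | no  _     = refl
... | yes 2^j≤n = ⊥-elim (ℕ.<⇒≱ n<2^j 2^j≤n)

maxBalance′-fuel : ∀ j d n → n < 2 ^ j → maxBalance′ (j + d) n ≡ maxBalance′ j n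
maxBalance′-fuel j zero    n n<2^j = cong (λ k → maxBalance′ k n) (ℕ.+-identityʳ j)
maxBalance′-fuel j (suc d) n n<2^j = begin
  maxBalance′ (j + suc d) n   ≡⟨ cong (λ k → maxBalance′ k n) (ℕ.+-suc j d) ⟩
  maxBalance′ (suc (j + d)) n ≡⟨ maxBalance′-< (j + d) n (ℕ.<-≤-trans n<2^j (ℕ.^-monoʳ-≤ 2 (ℕ.m≤m+n j d))) ⟩
  maxBalance′ (j + d) n       ≡⟨ maxBalance′-fuel j d n n<2^j ⟩
  maxBalance′ j n             ∎
  where open ≡-Reasoning

maxBalance′≡maxBalance : ∀ j n → n < 2 ^ j → maxBalance′ j n ≡ maxBalance n
maxBalance′≡maxBalance j n n<2^j with ℕ.≤-total j n
... | inj₁ j≤n with ℕ.m≤n⇒∃[o]m+o≡n j≤n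
...   | d , refl = sym (maxBalance′-fuel j d n n<2^j)
maxBalance′≡maxBalance j n n<2^j | inj₂ n≤j with ℕ.m≤n⇒∃[o]m+o≡n n≤j
...   | d , refl = maxBalance′-fuel n d n (n<2^n n)

maxBalance-unfold : ∀ j r → r < 2 ^ j →
                    maxBalance (2 ^ j + r) ≡ (2 ^ j ∸ 1) ÷ 1 ℚ.+ r ÷ 2 ^ j ℚ.+ maxBalance r
maxBalance-unfold j r r<2^j = begin
  maxBalance (2 ^ j + r)         ≡⟨ maxBalance′≡maxBalance (suc j) (2 ^ j + r) (2^j+r<2^1+j j r<2^j) ⟨
  maxBalance′ (suc j) (2 ^ j + r) ≡⟨ peel ⟩
  (2 ^ j ∸ 1) ÷ 1 ℚ.+ r ÷ 2 ^ j ℚ.+ maxBalance′ j r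
    ≡⟨ cong ((2 ^ j ∸ 1) ÷ 1 ℚ.+ r ÷ 2 ^ j ℚ.+_) (maxBalance′≡maxBalance j r r<2^j) ⟩
  (2 ^ j ∸ 1) ÷ 1 ℚ.+ r ÷ 2 ^ j ℚ.+ maxBalance r   ∎
  where
  open ≡-Reasoning
  peel : maxBalance′ (suc j) (2 ^ j + r) ≡ (2 ^ j ∸ 1) ÷ 1 ℚ.+ r ÷ 2 ^ j ℚ.+ maxBalance′ j r
  peel with 2 ^ j ≤? 2 ^ j + r
  ... | no  2^j≰n = ⊥-elim (2^j≰n (ℕ.m≤m+n (2 ^ j) r))
  ... | yes _     rewrite ℕ.m+n∸m≡n (2 ^ j) r = refl

maxBalance-unfold-double : ∀ i m → m < 2 ^ i + 2 ^ i →
                           maxBalance (2 ^ i + 2 ^ i + m)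
                             ≡ (2 ^ i + 2 ^ i ∸ 1) ÷ 1 ℚ.+ m ÷ (2 ^ i + 2 ^ i) ℚ.+ maxBalance m
maxBalance-unfold-double i m m<K rewrite sym (2^suc i) = maxBalance-unfold (suc i) m m<K

-- Upper bound

NodeBound : ℕ → ℕ → Set
NodeBound a b = balance a b ℚ.+ (maxBalance a ℚ.+ maxBalance b) ℚ.≤ maxBalance (a + b)

NodeBound< : ℕ → Set
NodeBound< n = ∀ a b → a + b < n → NodeBound a b

NodeBound-sym : ∀ a b → NodeBound a b → NodeBound b a
NodeBound-sym a b = subst₂ ℚ._≤_
  (cong₂ ℚ._+_ (balance-comm a b) (ℚ.+-comm (maxBalance a) (maxBalance b)))
  (cong maxBalance (ℕ.+-comm a b))

nodeBound-large : ∀ j a s → NodeBound< (2 ^ j) → a + s < 2 ^ j → NodeBound a (2 ^ j + s)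
nodeBound-large j a s ih a+s<K = begin
  balance a (K + s) ℚ.+ (maxBalance a ℚ.+ maxBalance (K + s))
    ≡⟨ cong₂ (λ β y → β ℚ.+ (maxBalance a ℚ.+ y)) (balance-≤ a≤K+s) (maxBalance-unfold j s s<K) ⟩
  a ÷ (K + s) ℚ.+ (maxBalance a ℚ.+ (c ℚ.+ s ÷ K ℚ.+ maxBalance s))
    ≡⟨ solve 5 (λ x p c u q → x :+ (p :+ (c :+ u :+ q)) := c :+ (x :+ u) :+ (p :+ q))
         refl (a ÷ (K + s)) (maxBalance a) c (s ÷ K) (maxBalance s) ⟩
  c ℚ.+ (a ÷ (K + s) ℚ.+ s ÷ K) ℚ.+ (maxBalance a ℚ.+ maxBalance s)
    ≤⟨ ℚ.+-mono-≤ (ℚ.+-monoʳ-≤ c root) (p≤q+p _ (÷-nonNeg (a ⊓ s) (a ⊔ s))) ⟩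
  c ℚ.+ (a + s) ÷ K ℚ.+ (balance a s ℚ.+ (maxBalance a ℚ.+ maxBalance s))
    ≤⟨ ℚ.+-monoʳ-≤ (c ℚ.+ (a + s) ÷ K) (ih a s a+s<K) ⟩
  c ℚ.+ (a + s) ÷ K ℚ.+ maxBalance (a + s)
    ≡⟨ maxBalance-unfold j (a + s) a+s<K ⟨
  maxBalance (K + (a + s))
    ≡⟨ cong maxBalance (x∙yz≈y∙xz K a s) ⟩
  maxBalance (a + (K + s)) ∎
  where
  open ℚ.≤-Reasoning
  K : ℕ
  K = 2 ^ j
  instance
    K≢0 : NonZero K
    K≢0 = m^n≢0 2 j
  c : ℚ
  c = (K ∸ 1) ÷ 1
  s<K : s < K
  s<K = ℕ.≤-<-trans (ℕ.m≤n+m s a) a+s<K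
  a≤K+s : a ≤ K + s
  a≤K+s = ℕ.≤-trans (ℕ.m≤m+n a s) (ℕ.≤-trans (ℕ.<⇒≤ a+s<K) (ℕ.m≤m+n K s))
  root : a ÷ (K + s) ℚ.+ s ÷ K ℚ.≤ (a + s) ÷ K
  root = ℚ.≤-trans (ℚ.+-monoˡ-≤ (s ÷ K) (÷-mono-≤ {a} {K + s} {a} ℕ.≤-refl (ℕ.m≤m+n K s)))
                   (ℚ.≤-reflexive (÷-+ a s K))

half≤max : ∀ {h a b} → a ≤ b → h + h ≤ a + b → h ≤ b
half≤max {h} {a} {b} a≤b 2h≤a+b = ℕ.≮⇒≥ λ b<h →
  ℕ.<⇒≱ (ℕ.+-mono-< (ℕ.≤-<-trans a≤b b<h) b<h) 2h≤a+b

module _ (i : ℕ) (ih : NodeBound< (2 ^ i + 2 ^ i)) where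
  private
    H K : ℕ
    H = 2 ^ i
    K = H + H
    c : ℚ
    c = (H ∸ 1) ÷ 1
    instance
      H≢0 : NonZero H
      H≢0 = m^n≢0 2 i

    merge-constants : ∀ x → c ℚ.+ c ℚ.+ (1ℚ ℚ.+ x) ≡ (K ∸ 1) ÷ 1 ℚ.+ x
    merge-constants x = trans (solve 2 (λ c x → c :+ c :+ (con 1ℚ :+ x) := c :+ c :+ con 1ℚ :+ x) refl c x)
                              (cong (ℚ._+ x) ([n∸1]+[n∸1]+1 H))

  nodeBound-both-upper : ∀ t s → t ≤ s → s < H → NodeBound (H + t) (H + s)
  nodeBound-both-upper t s t≤s s<H = begin
    balance (H + t) (H + s) ℚ.+ (maxBalance (H + t) ℚ.+ maxBalance (H + s))
      ≡⟨ cong₂ ℚ._+_ (balance-≤ (ℕ.+-monoʳ-≤ H t≤s))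
                     (cong₂ ℚ._+_ (maxBalance-unfold i t t<H) (maxBalance-unfold i s s<H)) ⟩
    (H + t) ÷ (H + s) ℚ.+ ((c ℚ.+ t ÷ H ℚ.+ maxBalance t) ℚ.+ (c ℚ.+ s ÷ H ℚ.+ maxBalance s))
      ≡⟨ solve 6 (λ x c u p v q → x :+ ((c :+ u :+ p) :+ (c :+ v :+ q)) := c :+ c :+ (x :+ v) :+ (u :+ (p :+ q)))
           refl ((H + t) ÷ (H + s)) c (t ÷ H) (maxBalance t) (s ÷ H) (maxBalance s) ⟩
    c ℚ.+ c ℚ.+ ((H + t) ÷ (H + s) ℚ.+ s ÷ H) ℚ.+ (t ÷ H ℚ.+ (maxBalance t ℚ.+ maxBalance s))
      ≤⟨ ℚ.+-mono-≤ (ℚ.+-monoʳ-≤ (c ℚ.+ c) root) subtrees ⟩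
    c ℚ.+ c ℚ.+ (1ℚ ℚ.+ (t + s) ÷ K) ℚ.+ maxBalance (t + s)
      ≡⟨ cong (ℚ._+ maxBalance (t + s)) (merge-constants ((t + s) ÷ K)) ⟩
    (K ∸ 1) ÷ 1 ℚ.+ (t + s) ÷ K ℚ.+ maxBalance (t + s)
      ≡⟨ maxBalance-unfold-double i (t + s) t+s<K ⟨
    maxBalance (K + (t + s))
      ≡⟨ cong maxBalance (interchange H H t s) ⟩
    maxBalance (H + t + (H + s)) ∎
    where
    open ℚ.≤-Reasoning
    t<H : t < H
    t<H = ℕ.≤-<-trans t≤s s<H
    t+s<K : t + s < K
    t+s<K = ℕ.+-mono-< t<H s<H
    root : (H + t) ÷ (H + s) ℚ.+ s ÷ H ℚ.≤ 1ℚ ℚ.+ (t + s) ÷ K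
    root = root-gain-bound H (H + t) s (t + s) (ℕ.<⇒≤ s<H) (ℕ.+-monoʳ-≤ H t≤s) (ℕ.+-assoc H t s)
    subtrees : t ÷ H ℚ.+ (maxBalance t ℚ.+ maxBalance s) ℚ.≤ maxBalance (t + s)
    subtrees = ℚ.≤-trans
      (ℚ.+-monoˡ-≤ _ (÷≤balance (ℕ.⊓-glb ℕ.≤-refl t≤s) (ℕ.⊔-lub (ℕ.<⇒≤ t<H) (ℕ.<⇒≤ s<H))))
      (ih t s t+s<K)

  nodeBound-straddle : ∀ a s m → a < H → s < H → a + s ≡ H + m → NodeBound a (H + s)
  nodeBound-straddle a s m a<H s<H a+s≡H+m = begin
    balance a (H + s) ℚ.+ (maxBalance a ℚ.+ maxBalance (H + s))
      ≡⟨ cong₂ (λ β y → β ℚ.+ (maxBalance a ℚ.+ y)) (balance-≤ a≤H+s) (maxBalance-unfold i s s<H) ⟩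
    a ÷ (H + s) ℚ.+ (maxBalance a ℚ.+ (c ℚ.+ s ÷ H ℚ.+ maxBalance s))
      ≡⟨ solve 5 (λ x p c u q → x :+ (p :+ (c :+ u :+ q)) := c :+ (x :+ u) :+ (p :+ q))
           refl (a ÷ (H + s)) (maxBalance a) c (s ÷ H) (maxBalance s) ⟩
    c ℚ.+ (a ÷ (H + s) ℚ.+ s ÷ H) ℚ.+ (maxBalance a ℚ.+ maxBalance s)
      ≤⟨ ℚ.+-mono-≤ (ℚ.+-monoʳ-≤ c root) subtrees ⟩
    c ℚ.+ (1ℚ ℚ.+ m ÷ K) ℚ.+ (c ℚ.+ maxBalance m)
      ≡⟨ solve 3 (λ c u q → c :+ u :+ (c :+ q) := c :+ c :+ u :+ q) refl c (1ℚ ℚ.+ m ÷ K) (maxBalance m) ⟩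
    c ℚ.+ c ℚ.+ (1ℚ ℚ.+ m ÷ K) ℚ.+ maxBalance m
      ≡⟨ cong (ℚ._+ maxBalance m) (merge-constants (m ÷ K)) ⟩
    (K ∸ 1) ÷ 1 ℚ.+ m ÷ K ℚ.+ maxBalance m
      ≡⟨ maxBalance-unfold-double i m m<K ⟨
    maxBalance (K + m)
      ≡⟨ cong maxBalance (trans (ℕ.+-assoc H H m)
                                (trans (cong (λ k → H + k) (sym a+s≡H+m)) (x∙yz≈y∙xz H a s))) ⟩
    maxBalance (a + (H + s)) ∎
    where
    open ℚ.≤-Reasoning
    a≤H+s : a ≤ H + s
    a≤H+s = ℕ.≤-trans (ℕ.<⇒≤ a<H) (ℕ.m≤m+n H s)
    H+m≤H+a : H + m ≤ H + a
    H+m≤H+a = subst₂ _≤_ a+s≡H+m (ℕ.+-comm a H) (ℕ.+-monoʳ-≤ a (ℕ.<⇒≤ s<H))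
    H+m≤H+s : H + m ≤ H + s
    H+m≤H+s = subst (_≤ H + s) a+s≡H+m (ℕ.+-monoˡ-≤ s (ℕ.<⇒≤ a<H))
    m≤a⊓s : m ≤ a ⊓ s
    m≤a⊓s = ℕ.⊓-glb (ℕ.+-cancelˡ-≤ H m a H+m≤H+a) (ℕ.+-cancelˡ-≤ H m s H+m≤H+s)
    m<H : m < H
    m<H = ℕ.≤-<-trans (ℕ.+-cancelˡ-≤ H m a H+m≤H+a) a<H
    m<K : m < K
    m<K = ℕ.<-≤-trans m<H (ℕ.m≤m+n H H)
    root : a ÷ (H + s) ℚ.+ s ÷ H ℚ.≤ 1ℚ ℚ.+ m ÷ K
    root = root-gain-bound H a s m (ℕ.<⇒≤ s<H) a≤H+s a+s≡H+m
    -- The bonus m ÷ H ≤ balance a s in the induction hypothesis absorbs the root term m ÷ H of maxBalance (H + m).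
    subtrees : maxBalance a ℚ.+ maxBalance s ℚ.≤ c ℚ.+ maxBalance m
    subtrees = +-cancelˡ-≤ (m ÷ H) (begin
      m ÷ H ℚ.+ (maxBalance a ℚ.+ maxBalance s)
        ≤⟨ ℚ.+-monoˡ-≤ _ (÷≤balance m≤a⊓s (ℕ.⊔-lub (ℕ.<⇒≤ a<H) (ℕ.<⇒≤ s<H))) ⟩
      balance a s ℚ.+ (maxBalance a ℚ.+ maxBalance s)
        ≤⟨ ih a s (ℕ.+-mono-< a<H s<H) ⟩
      maxBalance (a + s)
        ≡⟨ cong maxBalance a+s≡H+m ⟩
      maxBalance (H + m)
        ≡⟨ maxBalance-unfold i m m<H ⟩
      c ℚ.+ m ÷ H ℚ.+ maxBalance m
        ≡⟨ solve 3 (λ c u q → c :+ u :+ q := u :+ (c :+ q)) refl c (m ÷ H) (maxBalance m) ⟩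
      m ÷ H ℚ.+ (c ℚ.+ maxBalance m) ∎)

  nodeBound-halves : ∀ a b → a ≤ b → K ≤ a + b → b < K → NodeBound a b
  nodeBound-halves a b a≤b K≤a+b b<K with ℕ.m≤n⇒∃[o]m+o≡n (half≤max {H} a≤b K≤a+b)
  ... | s , refl with H ≤? a
  ...   | yes H≤a with ℕ.m≤n⇒∃[o]m+o≡n H≤a
  ...     | t , refl = nodeBound-both-upper t s (ℕ.+-cancelˡ-≤ H t s a≤b) (ℕ.+-cancelˡ-< H s H b<K)
  nodeBound-halves a _ a≤b K≤a+b b<K | s , refl | no H≰a with ℕ.m≤n⇒∃[o]m+o≡n H≤a+s
    where
    H≤a+s : H ≤ a + s
    H≤a+s = ℕ.+-cancelˡ-≤ H H (a + s) (subst (K ≤_) (x∙yz≈y∙xz a H s) K≤a+b)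
  ... | m , H+m≡a+s = nodeBound-straddle a s m (ℕ.≰⇒> H≰a) (ℕ.+-cancelˡ-< H s H b<K) (sym H+m≡a+s)

nodeBound-small : ∀ j → NodeBound< (2 ^ j) → ∀ a b → a ≤ b → 2 ^ j ≤ a + b → b < 2 ^ j → NodeBound a b
nodeBound-small zero    _  _ _ z≤n () (s≤s z≤n)
nodeBound-small (suc i) ih a b a≤b K≤a+b b<K =
  nodeBound-halves i (subst NodeBound< (2^suc i) ih) a b a≤b
    (subst (_≤ a + b) (2^suc i) K≤a+b) (subst (b <_) (2^suc i) b<K)

nodeBound-sorted : ∀ j → NodeBound< (2 ^ j) → ∀ a b → a ≤ b → 2 ^ j ≤ a + b → a + b < 2 ^ suc j →
                    NodeBound a b
nodeBound-sorted j ih a b a≤b K≤a+b a+b<2K with 2 ^ j ≤? b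
... | no  K≰b = nodeBound-small j ih a b a≤b K≤a+b (ℕ.≰⇒> K≰b)
... | yes K≤b with ℕ.m≤n⇒∃[o]m+o≡n K≤b
...   | s , refl = nodeBound-large j a s ih
  (ℕ.+-cancelˡ-< (2 ^ j) (a + s) (2 ^ j) (subst₂ _<_ (x∙yz≈y∙xz a (2 ^ j) s) (2^suc j) a+b<2K))

nodeBound-interval : ∀ j → NodeBound< (2 ^ j) → ∀ a b → 2 ^ j ≤ a + b → a + b < 2 ^ suc j → NodeBound a b
nodeBound-interval j ih a b K≤a+b a+b<2K with ℕ.≤-total a b
... | inj₁ a≤b = nodeBound-sorted j ih a b a≤b K≤a+b a+b<2K
... | inj₂ b≤a = NodeBound-sym b a (nodeBound-sorted j ih b a b≤a
  (subst (2 ^ j ≤_) (ℕ.+-comm a b) K≤a+b) (subst (_< 2 ^ suc j) (ℕ.+-comm a b) a+b<2K))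

nodeBound : ∀ a b → NodeBound a b
nodeBound a b = 2^j+r-induction (λ n → ∀ a b → a + b ≡ n → NodeBound a b) base step (a + b) a b refl
  where
  base : ∀ a b → a + b ≡ 0 → NodeBound a b
  base zero zero _ = ℚ.≤-refl
  step : ∀ j r → r < 2 ^ j → (∀ m → m < 2 ^ j → ∀ a b → a + b ≡ m → NodeBound a b) →
         ∀ a b → a + b ≡ 2 ^ j + r → NodeBound a b
  step j r r<K ih a b a+b≡K+r = nodeBound-interval j (λ a b a+b<K → ih (a + b) a+b<K a b refl) a b
    (subst (2 ^ j ≤_) (sym a+b≡K+r) (ℕ.m≤m+n (2 ^ j) r))
    (subst (_< 2 ^ suc j) (sym a+b≡K+r) (2^j+r<2^1+j j r<K))

leavesB-node : ∀ l r → leavesB (node l r) ≡ leavesB l + leavesB r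
leavesB-node l r = cong suc (sym (ℕ.+-suc (leaves-1 l) (leaves-1 r)))

balanceSum≤maxBalance : ∀ t → balanceSum t ℚ.≤ maxBalance (leavesB t)
balanceSum≤maxBalance leaf       = ℚ.≤-refl
balanceSum≤maxBalance (node l r) = begin
  balance (leavesB l) (leavesB r) ℚ.+ (balanceSum l ℚ.+ balanceSum r)
    ≤⟨ ℚ.+-monoʳ-≤ (balance (leavesB l) (leavesB r))
                   (ℚ.+-mono-≤ (balanceSum≤maxBalance l) (balanceSum≤maxBalance r)) ⟩
  balance (leavesB l) (leavesB r) ℚ.+ (maxBalance (leavesB l) ℚ.+ maxBalance (leavesB r))
    ≤⟨ nodeBound (leavesB l) (leavesB r) ⟩
  maxBalance (leavesB l + leavesB r)
    ≡⟨ cong maxBalance (leavesB-node l r) ⟨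
  maxBalance (leavesB (node l r)) ∎
  where open ℚ.≤-Reasoning

-- Optimal trees

perfect : ℕ → BTree
perfect zero    = leaf
perfect (suc i) = node (perfect i) (perfect i)

leavesB-perfect : ∀ i → leavesB (perfect i) ≡ 2 ^ i
leavesB-perfect zero    = refl
leavesB-perfect (suc i) = begin
  leavesB (perfect (suc i))                       ≡⟨ leavesB-node (perfect i) (perfect i) ⟩
  leavesB (perfect i) + leavesB (perfect i)       ≡⟨ cong₂ (λ x y → x + y) (leavesB-perfect i) (leavesB-perfect i) ⟩
  2 ^ i + 2 ^ i                                   ≡⟨ 2^suc i ⟨
  2 ^ suc i                                       ∎
  where open ≡-Reasoning

balanceSum-perfect : ∀ i → balanceSum (perfect i) ≡ (2 ^ i ∸ 1) ÷ 1
balanceSum-perfect zero    = refl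
balanceSum-perfect (suc i) = begin
  balance n n ℚ.+ (balanceSum (perfect i) ℚ.+ balanceSum (perfect i))
    ≡⟨ cong₂ (λ β x → β ℚ.+ (x ℚ.+ x)) (balance-self n) (balanceSum-perfect i) ⟩
  1ℚ ℚ.+ (c ℚ.+ c)
    ≡⟨ solve 1 (λ c → con 1ℚ :+ (c :+ c) := c :+ c :+ con 1ℚ) refl c ⟩
  c ℚ.+ c ℚ.+ 1ℚ
    ≡⟨ [n∸1]+[n∸1]+1 (2 ^ i) {{m^n≢0 2 i}} ⟩
  (2 ^ i + 2 ^ i ∸ 1) ÷ 1
    ≡⟨ cong (λ k → (k ∸ 1) ÷ 1) (2^suc i) ⟨
  (2 ^ suc i ∸ 1) ÷ 1 ∎
  where
  open ≡-Reasoning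
  n : ℕ
  n = leavesB (perfect i)
  c : ℚ
  c = (2 ^ i ∸ 1) ÷ 1

Attained : ℕ → Set
Attained n = Σ BTree λ t → leavesB t ≡ n × balanceSum t ≡ maxBalance n

maxBalance-attained : ∀ n .{{_ : NonZero n}} → Attained n
maxBalance-attained n@(suc _) = 2^j+r-induction (λ n → NonZero n → Attained n) (λ ()) step n _
  where
  step : ∀ j r → r < 2 ^ j → (∀ m → m < 2 ^ j → NonZero m → Attained m) →
         NonZero (2 ^ j + r) → Attained (2 ^ j + r)
  step j zero _ _ _ = perfect j , trans (leavesB-perfect j) (sym (ℕ.+-identityʳ (2 ^ j))) , (begin
    balanceSum (perfect j)                           ≡⟨ balanceSum-perfect j ⟩
    c                                                ≡⟨ solve 1 (λ c → c := c :+ con 0ℚ :+ con 0ℚ) refl c ⟩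
    c ℚ.+ 0ℚ ℚ.+ 0ℚ                                  ≡⟨ cong (λ x → c ℚ.+ x ℚ.+ 0ℚ) (0÷n≡0 (2 ^ j)) ⟨
    c ℚ.+ 0 ÷ 2 ^ j ℚ.+ maxBalance 0                 ≡⟨ maxBalance-unfold j 0 (ℕ.m^n>0 2 j) ⟨
    maxBalance (2 ^ j + 0)                           ∎)
    where
    open ≡-Reasoning
    c : ℚ
    c = (2 ^ j ∸ 1) ÷ 1
  step j r@(suc _) r<K ih _ with ih r r<K _
  ... | t , leaves-t , balanceSum-t = node (perfect j) t , leaves-node , (begin
    balance (leavesB (perfect j)) (leavesB t) ℚ.+ (balanceSum (perfect j) ℚ.+ balanceSum t)
      ≡⟨ cong₂ ℚ._+_ (cong₂ balance (leavesB-perfect j) leaves-t)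
                     (cong₂ ℚ._+_ (balanceSum-perfect j) balanceSum-t) ⟩
    balance (2 ^ j) r ℚ.+ (c ℚ.+ maxBalance r)
      ≡⟨ cong (ℚ._+ (c ℚ.+ maxBalance r)) (trans (balance-comm (2 ^ j) r) (balance-≤ (ℕ.<⇒≤ r<K))) ⟩
    r ÷ 2 ^ j ℚ.+ (c ℚ.+ maxBalance r)
      ≡⟨ solve 3 (λ u c p → u :+ (c :+ p) := c :+ u :+ p) refl (r ÷ 2 ^ j) c (maxBalance r) ⟩
    c ℚ.+ r ÷ 2 ^ j ℚ.+ maxBalance r
      ≡⟨ maxBalance-unfold j r r<K ⟨
    maxBalance (2 ^ j + r) ∎)
    where
    open ≡-Reasoning
    c : ℚ
    c = (2 ^ j ∸ 1) ÷ 1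
    leaves-node : leavesB (node (perfect j) t) ≡ 2 ^ j + r
    leaves-node = trans (leavesB-node (perfect j) t) (cong₂ (λ x y → x + y) (leavesB-perfect j) leaves-t)

⌊n/2⌋-double : ∀ n → ⌊ n /2⌋ + ⌊ n /2⌋ ≤ n × n ≤ suc (⌊ n /2⌋ + ⌊ n /2⌋)
⌊n/2⌋-double zero          = z≤n , z≤n
⌊n/2⌋-double (suc zero)    = z≤n , s≤s z≤n
⌊n/2⌋-double (suc (suc n)) with ⌊n/2⌋-double n
... | lower , upper = subst (_≤ suc (suc n)) (sym (ℕ.+-suc (suc h) h)) (s≤s (s≤s lower))
                    , s≤s (s≤s (subst (n ≤_) (sym (ℕ.+-suc h h)) upper))
  where
  h : ℕ
  h = ⌊ n /2⌋

⌊log₂⌋-suc : ∀ k → ⌊log₂ suc (suc k) ⌋ ≡ suc ⌊log₂ suc ⌊ k /2⌋ ⌋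
⌊log₂⌋-suc k = sym (cong suc (⌊log₂⌊n/2⌋⌋≡⌊log₂n⌋∸1 (suc (suc k))))

2^⌊log₂⌋-bounds : ∀ n → 2 ^ ⌊log₂ suc n ⌋ ≤ suc n × suc n < 2 ^ suc ⌊log₂ suc n ⌋
2^⌊log₂⌋-bounds = <-rec _ bounds
  where
  bounds : ∀ n → (∀ {m} → m < n → 2 ^ ⌊log₂ suc m ⌋ ≤ suc m × suc m < 2 ^ suc ⌊log₂ suc m ⌋) →
           2 ^ ⌊log₂ suc n ⌋ ≤ suc n × suc n < 2 ^ suc ⌊log₂ suc n ⌋
  bounds zero    _   = s≤s z≤n , s≤s (s≤s z≤n)
  bounds (suc k) rec with rec (s≤s (ℕ.⌊n/2⌋≤n k)) | ⌊n/2⌋-double (suc (suc k))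
  ... | 2^L≤h , h<2^1+L | h+h≤n , n≤1+h+h =
    subst (λ L → 2 ^ L ≤ suc (suc k) × suc (suc k) < 2 ^ suc L) (sym (⌊log₂⌋-suc k))
      ( subst (_≤ suc (suc k)) (sym (2^suc L)) (ℕ.≤-trans (ℕ.+-mono-≤ 2^L≤h 2^L≤h) h+h≤n)
      , subst (suc (suc k) <_) (sym (2^suc (suc L)))
          (ℕ.≤-<-trans n≤1+h+h (subst (_≤ 2 ^ suc L + 2 ^ suc L) (cong suc (ℕ.+-suc h h))
                                      (ℕ.+-mono-≤ h<2^1+L h<2^1+L))))
    where
    h L : ℕ
    h = suc ⌊ k /2⌋
    L = ⌊log₂ h ⌋

-- The maximal stairs2 index

maxSt2 : ℕ → ℚ
maxSt2 zero          = 0ℚ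
maxSt2 (suc zero)    = 0ℚ
maxSt2 (suc (suc m)) = (+ 1 / suc m) ℚ.* maxBalance (suc (suc m))

st2B≡maxSt2 : ∀ t → balanceSum t ≡ maxBalance (leavesB t) → st2B t ≡ maxSt2 (leavesB t)
st2B≡maxSt2 leaf       _  = refl
st2B≡maxSt2 (node l r) eq = cong (+ 1 / leaves-1 (node l r) ℚ.*_) eq

st2≤maxSt2 : ∀ T → st2 T ℚ.≤ maxSt2 (leaves T)
st2≤maxSt2 empty             = ℚ.≤-refl
st2≤maxSt2 (tree leaf)       = ℚ.≤-refl
st2≤maxSt2 (tree (node l r)) = ℚ.*-monoˡ-≤-nonNeg (+ 1 / leaves-1 (node l r))
  {{ℚ.normalize-nonNeg 1 (leaves-1 (node l r))}} (balanceSum≤maxBalance (node l r))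

maxSt2-attained : ∀ n → Σ RBTree λ T → leaves T ≡ n × st2 T ≡ maxSt2 n
maxSt2-attained zero = empty , refl , refl
maxSt2-attained (suc n) with maxBalance-attained (suc n)
... | t , refl , balanceSum-t = tree t , refl , st2B≡maxSt2 t balanceSum-t

isMaxSt2 : ∀ n → IsMaxSt2 n (maxSt2 n)
isMaxSt2 n = maxSt2-attained n , λ T leaves≡n → subst (λ k → st2 T ℚ.≤ maxSt2 k) leaves≡n (st2≤maxSt2 T)

IsMaxSt2-unique : ∀ {n p q} → IsMaxSt2 n p → IsMaxSt2 n q → p ≡ q
IsMaxSt2-unique ((T , leaves-T , refl) , p-max) ((T′ , leaves-T′ , refl) , q-max) =
  ℚ.≤-antisym (q-max T leaves-T) (p-max T′ leaves-T′)

[n-1]*maxSt2≡maxBalance : ∀ n → ((+ n ℤ.- + 1) / 1) ℚ.* maxSt2 n ≡ maxBalance n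
[n-1]*maxSt2≡maxBalance zero          = ℚ.*-zeroʳ ((+ 0 ℤ.- + 1) / 1)
[n-1]*maxSt2≡maxBalance (suc zero)    = ℚ.*-zeroʳ ((+ 1 ℤ.- + 1) / 1)
[n-1]*maxSt2≡maxBalance (suc (suc m)) = begin
  suc m ÷ 1 ℚ.* (1 ÷ suc m ℚ.* F)     ≡⟨ ℚ.*-assoc (suc m ÷ 1) (1 ÷ suc m) F ⟨
  suc m ÷ 1 ℚ.* (1 ÷ suc m) ℚ.* F     ≡⟨ cong (ℚ._* F) (÷-* (suc m) 1 1 (suc m)) ⟩
  (suc m * 1) ÷ (1 * suc m) ℚ.* F     ≡⟨ cong (ℚ._* F) (cong₂ _÷_ (ℕ.*-identityʳ (suc m)) (ℕ.*-identityˡ (suc m))) ⟩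
  suc m ÷ suc m ℚ.* F                 ≡⟨ cong (ℚ._* F) (n÷n≡1 (suc m)) ⟩
  1ℚ ℚ.* F                            ≡⟨ ℚ.*-identityˡ F ⟩
  F                                   ∎
  where
  open ≡-Reasoning
  F : ℚ
  F = maxBalance (suc (suc m))

maxBalance-recurrence : ∀ k q → let L = ⌊log₂ suc k ⌋; K = 2 ^ L; r = suc k ∸ K in
  IsMaxSt2 r q → maxBalance (suc k) ≡ (K ∸ 1) ÷ 1 ℚ.+ ((+ r ℤ.- + 1) / 1) ℚ.* q ℚ.+ (+ r / K) {{m^n≢0 2 L}}
maxBalance-recurrence k q q-max with 2^⌊log₂⌋-bounds k
... | K≤n , n<2K = begin
  maxBalance (suc k)
    ≡⟨ cong maxBalance (ℕ.m+[n∸m]≡n K≤n) ⟨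
  maxBalance (K + r)
    ≡⟨ maxBalance-unfold L r r<K ⟩
  c ℚ.+ r ÷ K ℚ.+ maxBalance r
    ≡⟨ cong (c ℚ.+ r ÷ K ℚ.+_) ([n-1]*maxSt2≡maxBalance r) ⟨
  c ℚ.+ r ÷ K ℚ.+ [r-1] ℚ.* maxSt2 r
    ≡⟨ cong (λ x → c ℚ.+ r ÷ K ℚ.+ [r-1] ℚ.* x) (IsMaxSt2-unique (isMaxSt2 r) q-max) ⟩
  c ℚ.+ r ÷ K ℚ.+ [r-1] ℚ.* q
    ≡⟨ solve 3 (λ c u p → c :+ u :+ p := c :+ p :+ u) refl c (r ÷ K) ([r-1] ℚ.* q) ⟩
  c ℚ.+ [r-1] ℚ.* q ℚ.+ r ÷ K
    ≡⟨ cong (c ℚ.+ [r-1] ℚ.* q ℚ.+_) (/≡÷ r K {{m^n≢0 2 L}}) ⟨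
  c ℚ.+ [r-1] ℚ.* q ℚ.+ (+ r / K) {{m^n≢0 2 L}} ∎
  where
  open ≡-Reasoning
  L K r : ℕ
  L = ⌊log₂ suc k ⌋
  K = 2 ^ L
  r = suc k ∸ K
  c [r-1] : ℚ
  c = (K ∸ 1) ÷ 1
  [r-1] = (+ r ℤ.- + 1) / 1
  r<K : r < K
  r<K = ℕ.+-cancelˡ-< K r K (subst₂ _<_ (sym (ℕ.m+[n∸m]≡n K≤n)) (2^suc L) n<2K)

corollary4p3 : (∀ (n : ℕ) → Σ ℚ (λ q → IsMaxSt2 n q))
    × IsMaxSt2 0 0ℚ
    × IsMaxSt2 1 0ℚ
    × (∀ (m : ℕ) (q : ℚ) →
         IsMaxSt2 (suc (suc m) ∸ 2 ^ ⌊log₂ suc (suc m) ⌋) q →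
         IsMaxSt2 (suc (suc m))
           (((+ 1) / suc m) ℚ.*
             (((+ (2 ^ ⌊log₂ suc (suc m) ⌋ ∸ 1)) / 1)
              ℚ.+ ((((+ (suc (suc m) ∸ 2 ^ ⌊log₂ suc (suc m) ⌋)) ℤ.- (+ 1)) / 1) ℚ.* q)
              ℚ.+ (_/_ (+ (suc (suc m) ∸ 2 ^ ⌊log₂ suc (suc m) ⌋))
                       (2 ^ ⌊log₂ suc (suc m) ⌋)
                       {{m^n≢0 2 ⌊log₂ suc (suc m) ⌋}}))))
corollary4p3 =
    (λ n → maxSt2 n , isMaxSt2 n)
  , isMaxSt2 0
  , isMaxSt2 1
  , λ m q q-max → subst (IsMaxSt2 (suc (suc m)))
                        (cong (+ 1 / suc m ℚ.*_) (maxBalance-recurrence (suc m) q q-max))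
                        (isMaxSt2 (suc (suc m)))
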